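{- Let $f$ be an $\mathsf{E}$-shop on a finite set $B$ with $|B|\geq 2$, and let $b\in B$ be such that $b\in f(x)$ for all $x\in B$. Then $\langle f\rangle$ contains an $\mathsf{E}$-shop $g$ for which there is a partition of $B$ into disjoint sets $B',B''$ with $B'$ non-empty such that (1) $g(x)\supseteq\{x,b\}$ for all $x\in B'$; (2) $g(x)\supseteq\{b\}$ for all $x\in B''$; (3) for every $y\in B$ there is $x\in B'$ with $y\in g(x)$.
   Context: A shop on a finite set $B$ is a map $f:B\to\mathfrak{P}(B)\setminus\{\emptyset\}$ such that every $y\in B$ lies in $f(x)$ for some $x\in B$. $f$ is an $\mathsf{E}$-shop if there is $b\in B$ with $b\in f(x)$ for all $x\in B$. The identity shop is $x\mapsto\{x\}$; composition is $(g\circ f)(x)=\{z:\exists y\,(y\in f(x)\wedge z\in g(y))\}$; $f$ is a sub-shop of $g$ if $f(x)\subseteq g(x)$ for all $x$. A down-she-monoid is a set of shops on $B$ containing the identity and closed under composition and under taking sub-shops (that are themselves shops). $\langle f\rangle$ denotes the smallest down-she-monoid containing $f$. -}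

module Defs where

open import Data.Nat using (ℕ)
open import Data.Fin using (Fin)
open import Data.Fin.Subset using (Subset; _∈_; _⊆_; Nonempty; ⁅_⁆)
open import Data.Fin.Subset.Properties using (_∈?_)
open import Data.Fin.Properties using (any?)
open import Data.Product using (∃; _×_)
open import Data.Vec using (tabulate)
open import Relation.Nullary using (does)
open import Relation.Nullary.Decidable using (_×-dec_)

-- A map B → 𝔓(B), with B = Fin n and subsets as characteristic vectors.
Map : ℕ → Set
Map n = Fin n → Subset n

IsShop : ∀ {n} → Map n → Set
IsShop {n} f = (∀ x → Nonempty (f x)) × (∀ (y : Fin n) → ∃ λ x → y ∈ f x)

IsEShop : ∀ {n} → Map n → Set
IsEShop {n} f = IsShop f × (∃ λ (b : Fin n) → ∀ x → b ∈ f x)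

idMap : ∀ {n} → Map n
idMap x = ⁅ x ⁆

-- composition (g ∘ f)(x) = { z : ∃ y, y ∈ f(x) ∧ z ∈ g(y) }
_⊚_ : ∀ {n} → Map n → Map n → Map n
(g ⊚ f) x = tabulate (λ z → does (any? (λ y → (y ∈? f x) ×-dec (z ∈? g y))))

_≤ₘ_ : ∀ {n} → Map n → Map n → Set
f ≤ₘ g = ∀ x → f x ⊆ g x

data ⟨_⟩ {n : ℕ} (f : Map n) : Map n → Set where
  gen  : ⟨ f ⟩ f
  ident : ⟨ f ⟩ idMap
  comp : ∀ {g h} → ⟨ f ⟩ g → ⟨ f ⟩ h → ⟨ f ⟩ (g ⊚ h)
  sub  : ∀ {g h} → ⟨ f ⟩ g → h ≤ₘ g → IsShop h → ⟨ f ⟩ h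

-- Choose for every y a predecessor p y with y ∈ f (p y). Walking back k steps along p shows
-- y ∈ fᵏ (pᵏ y), and b ∈ fᵏ x for all x once k ≥ 1. Every self-map p of an n-element set
-- satisfies p^M ∘ p^M = p^M for M = n!, because each orbit of p becomes periodic after at most
-- n steps with a period dividing n!. Hence with g = f^M and B′ = {x | x ∈ g x}, the point
-- x = p^M y lies in B′ (as x = p^M x) and covers y.
module Submission where

open import Defs
open import Data.Bool.Properties using (T-≡)
open import Data.Fin using (Fin; toℕ)
open import Data.Fin.Properties using (any?; pigeonhole; toℕ≤pred[n])
open import Data.Fin.Subset using (Subset; _∈_; _∉_; Nonempty)
open import Data.Fin.Subset.Properties using (_∈?_; x∈⁅x⁆)
open import Data.Nat using (ℕ; zero; suc; _+_; _*_; _∸_; _≤_; _<_; _!; NonZero; z≤n)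
open import Data.Nat.Divisibility using (_∣_; divides; ∣-trans; m∣m*n; m≤n⇒m!∣n!)
open import Data.Nat.Properties
  using (+-comm; n<1+n; m≤m*n; _!≢0; m∸n+n≡m; m<n⇒0<n∸m; m∸n≤m; <⇒≤; ≤-trans)
open import Data.Product using (∃; ∃₂; _×_; _,_; proj₁; proj₂)
open import Data.Vec using (tabulate)
open import Data.Vec.Properties using ([]=⇒lookup; lookup⇒[]=; lookup∘tabulate)
open import Function using (Equivalence; _∘_)
import Function.Endo.Propositional as Endo
open import Relation.Binary.PropositionalEquality
open import Relation.Nullary using (does)
open import Relation.Nullary.Decidable using (_×-dec_; dec-true; isYes≗does; toWitness)
open import Relation.Unary using (Decidable)

n≤n! : ∀ n → n ≤ n !
n≤n! zero    = z≤n
n≤n! (suc n) = m≤m*n (suc n) (n !) {{n !≢0}}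

0<m≤n⇒m∣n! : ∀ {m n} → 0 < m → m ≤ n → m ∣ n !
0<m≤n⇒m∣n! {suc m} _ m≤n = ∣-trans (m∣m*n (m !)) (m≤n⇒m!∣n! m≤n)

module _ {n : ℕ} {P : Fin n → Set} (P? : Decidable P) where

  ∈-tabulate⁺ : ∀ {x} → P x → x ∈ tabulate (does ∘ P?)
  ∈-tabulate⁺ {x} px = lookup⇒[]= x _ (trans (lookup∘tabulate (does ∘ P?) x) (dec-true (P? x) px))

  ∈-tabulate⁻ : ∀ {x} → x ∈ tabulate (does ∘ P?) → P x
  ∈-tabulate⁻ {x} x∈ = toWitness (Equivalence.from T-≡
    (trans (isYes≗does (P? x)) (trans (sym (lookup∘tabulate (does ∘ P?) x)) ([]=⇒lookup x∈))))

module Iteration {A : Set} (p : A → A) where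

  open Endo A using (_^_; ^-homo)

  ^-+ : ∀ a b x → (p ^ (a + b)) x ≡ (p ^ a) ((p ^ b) x)
  ^-+ a b = cong-app (^-homo p a b)

  ^-comm : ∀ a b x → (p ^ a) ((p ^ b) x) ≡ (p ^ b) ((p ^ a) x)
  ^-comm a b x = trans (sym (^-+ a b x)) (trans (cong (λ k → (p ^ k) x) (+-comm a b)) (^-+ b a x))

  module _ {L : ℕ} {w : A} (periodic : (p ^ L) w ≡ w) where

    periodic-^ : ∀ k → (p ^ L) ((p ^ k) w) ≡ (p ^ k) w
    periodic-^ k = trans (^-comm L k w) (cong (p ^ k) periodic)

    periodic-* : ∀ c → (p ^ (c * L)) w ≡ w
    periodic-* zero    = refl
    periodic-* (suc c) = trans (^-+ L (c * L) w) (trans (cong (p ^ L) (periodic-* c)) periodic)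

module FiniteIteration {n : ℕ} (p : Fin n → Fin n) where

  open Endo (Fin n) using (_^_)
  open Iteration p

  eventually-periodic : ∀ y → ∃₂ λ i L → i ≤ n × 0 < L × L ≤ n × (p ^ L) ((p ^ i) y) ≡ (p ^ i) y
  eventually-periodic y with pigeonhole (n<1+n n) (λ i → (p ^ toℕ i) y)
  ... | i , j , i<j , pⁱy≡pʲy = toℕ i , L , ≤-trans (<⇒≤ i<j) (toℕ≤pred[n] j) ,
      m<n⇒0<n∸m i<j , ≤-trans (m∸n≤m (toℕ j) (toℕ i)) (toℕ≤pred[n] j) , periodic
    where
    L = toℕ j ∸ toℕ i
    periodic : (p ^ L) ((p ^ toℕ i) y) ≡ (p ^ toℕ i) y
    periodic = begin
      (p ^ L) ((p ^ toℕ i) y) ≡⟨ ^-+ L (toℕ i) y ⟨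
      (p ^ (L + toℕ i)) y     ≡⟨ cong (λ k → (p ^ k) y) (m∸n+n≡m (<⇒≤ i<j)) ⟩
      (p ^ toℕ j) y           ≡⟨ pⁱy≡pʲy ⟨
      (p ^ toℕ i) y           ∎
      where open ≡-Reasoning

  ^n!-idempotent : ∀ y → (p ^ (n !)) ((p ^ (n !)) y) ≡ (p ^ (n !)) y
  ^n!-idempotent y with eventually-periodic y
  ... | i , L , i≤n , 0<L , L≤n , periodic with 0<m≤n⇒m∣n! {n = n} 0<L L≤n
  ... | divides c n!≡c*L = begin
      (p ^ (n !)) ((p ^ (n !)) y) ≡⟨ cong (p ^ (n !)) pⁿ!y≡w ⟩
      (p ^ (n !)) w               ≡⟨ cong (λ k → (p ^ k) w) n!≡c*L ⟩
      (p ^ (c * L)) w             ≡⟨ periodic-* (periodic-^ {L = L} periodic (n ! ∸ i)) c ⟩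
      w                           ≡⟨ pⁿ!y≡w ⟨
      (p ^ (n !)) y               ∎
    where
    open ≡-Reasoning
    w = (p ^ (n ! ∸ i)) ((p ^ i) y)
    pⁿ!y≡w : (p ^ (n !)) y ≡ w
    pⁿ!y≡w = trans (cong (λ k → (p ^ k) y) (sym (m∸n+n≡m (≤-trans i≤n (n≤n! n))))) (^-+ (n ! ∸ i) i y)

infixl 8 _⊚^_

_⊚^_ : ∀ {n} → Map n → ℕ → Map n
f ⊚^ zero  = idMap
f ⊚^ suc k = (f ⊚^ k) ⊚ f

module _ {n : ℕ} where

  ∈-⊚ : ∀ g h {x y z} → y ∈ h x → z ∈ g y → z ∈ (g ⊚ h) x
  ∈-⊚ g h {x} {y} y∈hx z∈gy =
    ∈-tabulate⁺ {n} (λ z → any? (λ y → (y ∈? h x) ×-dec (z ∈? g y))) (y , y∈hx , z∈gy)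

  module Powers (f : Map n) where

    ⊚^-∈⟨⟩ : ∀ k → ⟨ f ⟩ (f ⊚^ k)
    ⊚^-∈⟨⟩ zero    = ident
    ⊚^-∈⟨⟩ (suc k) = comp (⊚^-∈⟨⟩ k) gen

    module _ {b : Fin n} (b∈f : ∀ x → b ∈ f x) where

      common-∈-⊚^-self : ∀ k → b ∈ (f ⊚^ k) b
      common-∈-⊚^-self zero    = x∈⁅x⁆ b
      common-∈-⊚^-self (suc k) = ∈-⊚ (f ⊚^ k) f (b∈f b) (common-∈-⊚^-self k)

      common-∈-⊚^ : ∀ k .{{_ : NonZero k}} x → b ∈ (f ⊚^ k) x
      common-∈-⊚^ (suc k) x = ∈-⊚ (f ⊚^ k) f (b∈f x) (common-∈-⊚^-self k)

    open Endo (Fin n) using (_^_)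

    ∈-⊚^-predecessor : ∀ {p : Fin n → Fin n} → (∀ y → y ∈ f (p y)) → ∀ k y → y ∈ (f ⊚^ k) ((p ^ k) y)
    ∈-⊚^-predecessor y∈fpy zero    y = x∈⁅x⁆ y
    ∈-⊚^-predecessor y∈fpy (suc k) y = ∈-⊚ (f ⊚^ k) f (y∈fpy _) (∈-⊚^-predecessor y∈fpy k y)

lemma3p6 : (n : ℕ) → 2 ≤ n → (f : Map n) → IsEShop f → (b : Fin n) → (∀ x → b ∈ f x) →
    ∃ λ (g : Map n) → ⟨ f ⟩ g × IsEShop g ×
      (∃ λ (B′ : Subset n) → Nonempty B′ ×
        (∀ x → x ∈ B′ → (x ∈ g x × b ∈ g x)) ×
        (∀ x → x ∉ B′ → b ∈ g x) ×
        (∀ y → ∃ λ x → x ∈ B′ × y ∈ g x))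
lemma3p6 n _ f ((_ , covered) , _) b b∈f =
  g , ⊚^-∈⟨⟩ (n !) , (((λ x → b , b∈g x) , (λ y → _ , y∈g[pᴹy] y)) , (b , b∈g)) ,
  B′ , (b , ∈-tabulate⁺ reflexive? (b∈g b)) ,
  (λ x x∈B′ → ∈-tabulate⁻ reflexive? x∈B′ , b∈g x) ,
  (λ x _ → b∈g x) ,
  (λ y → (p ^ (n !)) y , ∈-tabulate⁺ reflexive? (pᴹy∈g[pᴹy] y) , y∈g[pᴹy] y)
  where
  open Powers f
  open Endo (Fin n) using (_^_)

  p : Fin n → Fin n
  p y = proj₁ (covered y)

  g : Map n
  g = f ⊚^ (n !)

  b∈g : ∀ x → b ∈ g x
  b∈g = common-∈-⊚^ b∈f (n !) {{n !≢0}}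

  y∈g[pᴹy] : ∀ y → y ∈ g ((p ^ (n !)) y)
  y∈g[pᴹy] = ∈-⊚^-predecessor (proj₂ ∘ covered) (n !)

  pᴹy∈g[pᴹy] : ∀ y → (p ^ (n !)) y ∈ g ((p ^ (n !)) y)
  pᴹy∈g[pᴹy] y = subst (λ x → (p ^ (n !)) y ∈ g x)
    (FiniteIteration.^n!-idempotent p y) (y∈g[pᴹy] ((p ^ (n !)) y))

  reflexive? : Decidable (λ x → x ∈ g x)
  reflexive? x = x ∈? g x

  B′ : Subset n
  B′ = tabulate (does ∘ reflexive?)
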